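{- Let $f:\mathbb{Z}\to\mathbb{Z}$ be a function such that $\langle\mathbb{Z},+,-,0,f\rangle$ satisfies (A1.1)–(A1.4). Then the structure $\langle\mathbb{Z},+,-,0,f\rangle$ has the strict order property.
   Context: Axioms: (A1.1) $\langle\mathbb{Z},+,-,0\rangle$ is a $\mathbb{Z}$-group (automatic here); (A1.2) for all $x,y$, $f(x+y)=f(x)+f(y)$ or $f(x+y)=f(x)+f(y)+1$; (A1.3) for all $x\ne0$, $f(-x)=-f(x)-1$; (A1.4) for all $x\neq0$, $f(f(x))=f(x)+x-1$, and for all $x$, $f(f(x)+x)=2f(x)+x$. -}

module Defs where

open import Data.Nat using (ℕ; suc) renaming (_+_ to _+ℕ_; _<_ to _<ℕ_)
open import Data.Integer using (ℤ; _+_; -_; _-_; 0ℤ; 1ℤ)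
open import Data.Fin using (Fin)
open import Data.Vec using (Vec; lookup; _∷_; _++_)
open import Data.Product using (Σ; _×_; ∃)
open import Data.Sum using (_⊎_)
open import Data.Empty using (⊥)
open import Data.Unit using (⊤)
open import Relation.Nullary using (¬_)
open import Relation.Binary.PropositionalEquality using (_≡_; _≢_)

-- Axioms (A1.2)-(A1.4) for a unary function f : ℤ → ℤ  ((A1.1) is automatic).
record Axioms (f : ℤ → ℤ) : Set where
  field
    A1-2  : ∀ x y → (f (x + y) ≡ f x + f y) ⊎ (f (x + y) ≡ f x + f y + 1ℤ)
    A1-3  : ∀ x → x ≢ 0ℤ → f (- x) ≡ - f x - 1ℤ
    A1-4a : ∀ x → x ≢ 0ℤ → f (f x) ≡ f x + x - 1ℤ
    A1-4b : ∀ x → f (f x + x) ≡ (f x + f x) + x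

data Term (n : ℕ) : Set where
  var  : Fin n → Term n
  zero : Term n
  plus : Term n → Term n → Term n
  neg  : Term n → Term n
  app  : Term n → Term n

data Formula : ℕ → Set where
  eq     : ∀ {n} → Term n → Term n → Formula n
  falsum : ∀ {n} → Formula n
  truth  : ∀ {n} → Formula n
  not    : ∀ {n} → Formula n → Formula n
  and    : ∀ {n} → Formula n → Formula n → Formula n
  or     : ∀ {n} → Formula n → Formula n → Formula n
  imp    : ∀ {n} → Formula n → Formula n → Formula n
  ex     : ∀ {n} → Formula (suc n) → Formula n   -- binds variable 0
  all    : ∀ {n} → Formula (suc n) → Formula n   -- binds variable 0

evalT : (f : ℤ → ℤ) → ∀ {n} → Term n → Vec ℤ n → ℤ
evalT f (var i)    ρ = lookup ρ i
evalT f zero       ρ = 0ℤ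
evalT f (plus s t) ρ = evalT f s ρ + evalT f t ρ
evalT f (neg t)    ρ = - evalT f t ρ
evalT f (app t)    ρ = f (evalT f t ρ)

Sat : (f : ℤ → ℤ) → ∀ {n} → Formula n → Vec ℤ n → Set
Sat f (eq s t)  ρ = evalT f s ρ ≡ evalT f t ρ
Sat f falsum    ρ = ⊥
Sat f truth     ρ = ⊤
Sat f (not φ)   ρ = ¬ Sat f φ ρ
Sat f (and φ ψ) ρ = Sat f φ ρ × Sat f ψ ρ
Sat f (or φ ψ)  ρ = Sat f φ ρ ⊎ Sat f ψ ρ
Sat f (imp φ ψ) ρ = Sat f φ ρ → Sat f ψ ρ
Sat f (ex φ)    ρ = Σ ℤ λ a → Sat f φ (a ∷ ρ)
Sat f (all φ)   ρ = (a : ℤ) → Sat f φ (a ∷ ρ)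

-- φ(M, b) ⊊ φ(M, c) for a formula φ(x̄; ȳ) with |x̄| = k, |ȳ| = m.
StrictSub : (f : ℤ → ℤ) → ∀ {k m} → Formula (k +ℕ m) → Vec ℤ m → Vec ℤ m → Set
StrictSub f {k} φ b c =
  ((a : Vec ℤ k) → Sat f φ (a ++ b) → Sat f φ (a ++ c))
  × Σ (Vec ℤ k) (λ a → Sat f φ (a ++ c) × ¬ Sat f φ (a ++ b))

HasSOP : (f : ℤ → ℤ) → Set
HasSOP f = Σ ℕ λ k → Σ ℕ λ m → Σ (Formula (k +ℕ m)) λ φ →
  Σ (ℕ → Vec ℤ m) λ b → ∀ i j → i <ℕ j → StrictSub f {k} {m} φ (b i) (b j)

-- For b ≠ 0, (A1.4) gives f (τ b) = f b + τ b and f (f b) = τ b − 1.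
-- Computing f (x + τ b) = f ((x + b) + f b) both ways with (A1.2) shows that every x with
-- f (x + b) = f x + f b also satisfies f (x + τ b) = f x + f (τ b); moreover τ b ≠ 0, and
-- x = f b satisfies the second equation but not the first. So along the orbit 1, τ 1, τ² 1, …
-- the sets defined by f (x + y) = f x + f y increase strictly.
module Submission where

open import Defs
open import Data.Integer using (ℤ; _+_; -_; _-_; 0ℤ; 1ℤ; +_)
open import Data.Integer.Properties using (+-identityʳ; +-0-abelianGroup)
open import Algebra.Properties.AbelianGroup +-0-abelianGroup using (∙-cancelˡ)
open import Data.Integer.Tactic.RingSolver using (solve-∀)
open import Data.Nat using (ℕ; zero; suc; _<_; _≤′_; ≤′-refl; ≤′-step)
open import Data.Nat.Properties using (≤⇒≤′; <⇒≤)
open import Data.Fin using () renaming (zero to fz; suc to fs)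
open import Data.Vec using (_∷_; [])
open import Data.Product using (_,_)
open import Data.Sum using (_⊎_; inj₁; inj₂)
open import Relation.Nullary using (¬_)
open import Relation.Binary.PropositionalEquality
  using (_≡_; _≢_; sym; trans; cong; module ≡-Reasoning)

open ≡-Reasoning

i+j≡i⇒j≡0 : ∀ i j → i + j ≡ i → j ≡ 0ℤ
i+j≡i⇒j≡0 i j e = ∙-cancelˡ i j 0ℤ (trans e (sym (+-identityʳ i)))

module AdditivityShifts (f : ℤ → ℤ) (ax : Axioms f) where
  open Axioms ax

  Additive : ℤ → ℤ → Set
  Additive x y = f (x + y) ≡ f x + f y

  τ : ℤ → ℤ
  τ b = f b + b

  defect∈01 : ∀ {x y k} → f (x + y) ≡ f x + f y + k → k ≡ 0ℤ ⊎ k ≡ 1ℤ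
  defect∈01 {x} {y} {k} e with A1-2 x y
  ... | inj₁ p = inj₁ (i+j≡i⇒j≡0 (f x + f y) k (trans (sym e) p))
  ... | inj₂ p = inj₂ (∙-cancelˡ (f x + f y) k 1ℤ (trans (sym e) p))

  f∘τ : ∀ b → f (τ b) ≡ f b + τ b
  f∘τ b = trans (A1-4b b) (reassoc (f b) b)
    where
    reassoc : ∀ c b → c + c + b ≡ c + (c + b)
    reassoc = solve-∀

  τ-nonzero : ∀ {b} → b ≢ 0ℤ → τ b ≢ 0ℤ
  τ-nonzero {b} b≢0 τb≡0 = b≢0 b≡0
    where
    fb≡-b : f b ≡ - b
    fb≡-b = begin
      f b           ≡⟨ shift (f b) b ⟩
      f b + b - b   ≡⟨ cong (_- b) τb≡0 ⟩
      0ℤ - b        ≡⟨ zero-minus b ⟩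
      - b           ∎
      where
      shift : ∀ c b → c ≡ c + b - b
      shift = solve-∀
      zero-minus : ∀ b → 0ℤ - b ≡ - b
      zero-minus = solve-∀

    -- f (- b) is computed once as f (f b) via (A1.4) and once via (A1.3).
    f[-b]≡-1 : f (- b) ≡ - 1ℤ
    f[-b]≡-1 = begin
      f (- b)        ≡⟨ cong f (sym fb≡-b) ⟩
      f (f b)        ≡⟨ A1-4a b b≢0 ⟩
      τ b - 1ℤ       ≡⟨ cong (_- 1ℤ) τb≡0 ⟩
      - 1ℤ           ∎

    f[-b]≡b-1 : f (- b) ≡ b - 1ℤ
    f[-b]≡b-1 = begin
      f (- b)        ≡⟨ A1-3 b b≢0 ⟩
      - f b - 1ℤ     ≡⟨ cong (λ z → - z - 1ℤ) fb≡-b ⟩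
      - (- b) - 1ℤ   ≡⟨ double-neg b ⟩
      b - 1ℤ         ∎
      where
      double-neg : ∀ b → - (- b) - 1ℤ ≡ b - 1ℤ
      double-neg = solve-∀

    b≡0 : b ≡ 0ℤ
    b≡0 = begin
      b              ≡⟨ minus-plus b ⟩
      b - 1ℤ + 1ℤ    ≡⟨ cong (_+ 1ℤ) (trans (sym f[-b]≡b-1) f[-b]≡-1) ⟩
      - 1ℤ + 1ℤ      ≡⟨⟩
      0ℤ             ∎
      where
      minus-plus : ∀ b → b ≡ b - 1ℤ + 1ℤ
      minus-plus = solve-∀

  -- If the defect of (x, τ b) were 1, then (x + b, f b) would have defect 2.
  additive-τ : ∀ {x b} → b ≢ 0ℤ → Additive x b → Additive x (τ b)
  additive-τ {x} {b} b≢0 additive with A1-2 x (τ b)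
  ... | inj₁ p = p
  ... | inj₂ p with defect∈01 defect-2
    where
    regroup : ∀ x b c → x + b + c ≡ x + (c + b)
    regroup = solve-∀
    rearrange : ∀ u c t → u + (c + t) + 1ℤ ≡ u + c + (t - 1ℤ) + + 2
    rearrange = solve-∀
    defect-2 : f (x + b + f b) ≡ f (x + b) + f (f b) + + 2
    defect-2 = begin
      f (x + b + f b)                  ≡⟨ cong f (regroup x b (f b)) ⟩
      f (x + τ b)                      ≡⟨ p ⟩
      f x + f (τ b) + 1ℤ               ≡⟨ cong (λ z → f x + z + 1ℤ) (f∘τ b) ⟩
      f x + (f b + τ b) + 1ℤ           ≡⟨ rearrange (f x) (f b) (τ b) ⟩
      f x + f b + (τ b - 1ℤ) + + 2     ≡⟨ cong (λ z → z + (τ b - 1ℤ) + + 2) (sym additive) ⟩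
      f (x + b) + (τ b - 1ℤ) + + 2     ≡⟨ cong (λ z → f (x + b) + z + + 2) (sym (A1-4a b b≢0)) ⟩
      f (x + b) + f (f b) + + 2        ∎
  ...   | inj₁ ()
  ...   | inj₂ ()

  f-not-additive : ∀ {b} → b ≢ 0ℤ → ¬ Additive (f b) b
  f-not-additive {b} b≢0 additive with i+j≡i⇒j≡0 (f (f b) + f b) 1ℤ defect-1
    where
    rearrange : ∀ c t → t - 1ℤ + c + 1ℤ ≡ c + t
    rearrange = solve-∀
    defect-1 : f (f b) + f b + 1ℤ ≡ f (f b) + f b
    defect-1 = begin
      f (f b) + f b + 1ℤ          ≡⟨ cong (λ z → z + f b + 1ℤ) (A1-4a b b≢0) ⟩
      τ b - 1ℤ + f b + 1ℤ         ≡⟨ rearrange (f b) (τ b) ⟩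
      f b + τ b                   ≡⟨ sym (f∘τ b) ⟩
      f (τ b)                     ≡⟨ additive ⟩
      f (f b) + f b               ∎
  ... | ()

  f-additive-τ : ∀ {b} → b ≢ 0ℤ → Additive (f b) (τ b)
  f-additive-τ {b} b≢0 = begin
    f (f b + τ b)               ≡⟨ cong f (sym (f∘τ b)) ⟩
    f (f (τ b))                 ≡⟨ A1-4a (τ b) (τ-nonzero b≢0) ⟩
    f (τ b) + τ b - 1ℤ          ≡⟨ swap (f (τ b)) (τ b) ⟩
    τ b - 1ℤ + f (τ b)          ≡⟨ cong (_+ f (τ b)) (sym (A1-4a b b≢0)) ⟩
    f (f b) + f (τ b)           ∎
    where
    swap : ∀ c t → c + t - 1ℤ ≡ t - 1ℤ + c
    swap = solve-∀

  orbit : ℕ → ℤ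
  orbit zero    = 1ℤ
  orbit (suc n) = τ (orbit n)

  orbit-nonzero : ∀ n → orbit n ≢ 0ℤ
  orbit-nonzero zero    ()
  orbit-nonzero (suc n) = τ-nonzero (orbit-nonzero n)

  additive-orbit-mono : ∀ {x m n} → m ≤′ n → Additive x (orbit m) → Additive x (orbit n)
  additive-orbit-mono ≤′-refl          additive = additive
  additive-orbit-mono (≤′-step {n} m≤n) additive =
    additive-τ (orbit-nonzero n) (additive-orbit-mono m≤n additive)

-- Variable 0 is the object variable x, variable 1 the parameter y.
additivity : Formula 2
additivity = eq (app (plus (var fz) (var (fs fz)))) (plus (app (var fz)) (app (var (fs fz))))

corollary2p6 : (f : ℤ → ℤ) → Axioms f → HasSOP f
corollary2p6 f ax = 1 , 1 , additivity , (λ n → orbit n ∷ []) , increasing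
  where
  open AdditivityShifts f ax

  increasing : ∀ i j → i < j → StrictSub f additivity (orbit i ∷ []) (orbit j ∷ [])
  increasing i j i<j =
    (λ { (x ∷ []) → additive-orbit-mono (≤⇒≤′ (<⇒≤ i<j)) }) ,
    (f (orbit i) ∷ [] ,
     additive-orbit-mono (≤⇒≤′ i<j) (f-additive-τ (orbit-nonzero i)) ,
     f-not-additive (orbit-nonzero i))
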